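{- For every integer $k\geq 1$ there exists an AT-free graph whose neighbourhood hypergraph has Helly number at least $k$, and for every integer $d\geq 1$ there exists an AT-free graph whose neighbourhood hypergraph has VC-dimension at least $d$.
   Context: All graphs are finite and simple. Three vertices form an asteroidal triple if between any two of them there is a path avoiding the closed neighbourhood of the third; a graph is AT-free if it has none. The neighbourhood hypergraph of $G=(V,E)$ is ${\cal N}(G)=(V,\{N[v]: v\in V\})$, $N[v]$ being the closed neighbourhood. Its Helly number is the smallest $k$ such that every family of hyperedges which pairwise... $k$-wise intersect (every $k$ of them have a common element) has nonempty total intersection. Its VC-dimension is the largest $d$ such that some $X\subseteq V$ with $|X|=d$ is shattered, i.e., for every $Y\subseteq X$ there is $v\in V$ with $N[v]\cap X=Y$. -}

module Defs where

open import Data.Nat using (ℕ; _≤_)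
open import Data.Bool using (Bool; true; false; _∨_)
open import Data.Fin using (Fin; _≟_)
open import Data.Fin.Subset using (Subset; _∈_; _∉_; _⊆_; _∩_; ∣_∣)
open import Data.Vec using (tabulate)
open import Data.Product using (Σ; ∃; ∃-syntax; _×_)
open import Relation.Nullary using (¬_)
open import Relation.Nullary.Decidable using (⌊_⌋)
open import Relation.Binary.PropositionalEquality using (_≡_; _≢_)

record Graph (n : ℕ) : Set where
  field
    adj    : Fin n → Fin n → Bool
    sym    : ∀ u v → adj u v ≡ adj v u
    irrefl : ∀ v → adj v v ≡ false
open Graph public

N[_]_ : ∀ {n} → Fin n → Graph n → Subset n
N[ v ] G = tabulate (λ u → ⌊ v ≟ u ⌋ ∨ adj G v u)

-- a walk from a to b all of whose vertices lie outside S
-- (a walk avoiding S exists iff a path avoiding S exists)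
data WalkAvoiding {n : ℕ} (G : Graph n) (S : Subset n) : Fin n → Fin n → Set where
  here : ∀ {a} → a ∉ S → WalkAvoiding G S a a
  step : ∀ {a b c} → a ∉ S → adj G a b ≡ true → WalkAvoiding G S b c → WalkAvoiding G S a c

AsteroidalTriple : ∀ {n} → Graph n → Fin n → Fin n → Fin n → Set
AsteroidalTriple G x y z =
  x ≢ y × x ≢ z × y ≢ z ×
  WalkAvoiding G (N[ z ] G) x y ×
  WalkAvoiding G (N[ y ] G) x z ×
  WalkAvoiding G (N[ x ] G) y z

ATFree : ∀ {n} → Graph n → Set
ATFree {n} G = ∀ (x y z : Fin n) → ¬ AsteroidalTriple G x y z

-- A family of hyperedges of the neighbourhood hypergraph is given by a set C
-- of centres (the family {N[v] : v ∈ C}).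
KWiseIntersecting : ∀ {n} → Graph n → ℕ → Subset n → Set
KWiseIntersecting {n} G k C =
  ∀ (S : Subset n) → S ⊆ C → ∣ S ∣ ≤ k →
    ∃[ x ] (∀ v → v ∈ S → x ∈ N[ v ] G)

HasCommonElement : ∀ {n} → Graph n → Subset n → Set
HasCommonElement {n} G C = ∃[ x ] (∀ v → v ∈ C → x ∈ N[ v ] G)

HellyProperty : ∀ {n} → Graph n → ℕ → Set
HellyProperty {n} G k =
  ∀ (C : Subset n) → KWiseIntersecting G k C → HasCommonElement G C

HellyNumberAtLeast : ∀ {n} → Graph n → ℕ → Set
HellyNumberAtLeast G k = ∀ j → HellyProperty G j → k ≤ j

Shattered : ∀ {n} → Graph n → Subset n → Set
Shattered {n} G X = ∀ (Y : Subset n) → Y ⊆ X → ∃[ v ] ((N[ v ] G) ∩ X ≡ Y)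

VCDimAtLeast : ∀ {n} → Graph n → ℕ → Set
VCDimAtLeast {n} G d = ∃[ X ] (Shattered G X × d ≤ ∣ X ∣)

-- Both families are co-bipartite: the vertex set is covered by two cliques.
-- Such graphs are AT-free, since two vertices of any triple share a clique,
-- whereas an asteroidal triple is independent.
-- In the cocktail party graph on 2k vertices (all edges but a perfect matching)
-- N[v] misses only the partner of v, so fewer than k closed neighbourhoods have
-- a common element while all of them do not: the Helly number is at least k.
-- For the VC-dimension, join a d-clique to a 2^d-clique so that the cross
-- neighbourhoods of the second clique realise every subset of the first one.
module Submission where

open import Defs hiding (sym)
open import Data.Bool using (Bool; true; false; not; _∨_; _∧_)
open import Data.Bool.Properties using (∧-identityʳ; ∧-zeroʳ)
open import Data.Fin using (Fin; zero; suc; _≟_; splitAt; join; _↑ˡ_; _↑ʳ_; finToFun; funToFin)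
open import Data.Fin.Properties
  using (splitAt-↑ˡ; splitAt-↑ʳ; splitAt⁻¹-↑ˡ; splitAt⁻¹-↑ʳ; splitAt-join; join-splitAt;
         2↔Bool; finToFun-funToFin)
open import Data.Fin.Subset using (Subset; _∈_; _∉_; _⊆_; _∩_; ∣_∣; ⊤; ⊥; inside; outside)
open import Data.Fin.Subset.Properties using (∈⊤; ∉⊥; drop-there; drop-∷-⊆; ∣p∣≤∣x∷p∣; Empty-unique)
open import Data.Nat using (ℕ; zero; suc; _+_; _^_; _≤_; _<_; z≤n; s≤s)
open import Data.Nat.Properties using (≮⇒≥; ≤-<-trans)
open import Data.Product using (Σ; ∃-syntax; _×_; _,_)
open import Data.Sum using (_⊎_; inj₁; inj₂; [_,_]′; swap)
open import Data.Vec using ([]; _∷_; lookup; tabulate; _++_)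
open import Data.Vec.Properties
  using (lookup∘tabulate; tabulate∘lookup; tabulate-cong; lookup-zipWith; lookup-replicate;
         lookup-++ˡ; lookup-++ʳ; []=⇒lookup; lookup⇒[]=)
import Data.Vec as Vec using (splitAt)
open import Data.Vec.Relation.Binary.Pointwise.Extensional using (ext; Pointwise-≡⇒≡)
open import Function using (_∘_; const; Inverse; mk⇔)
open import Relation.Nullary using (¬_; Dec; yes; no; does)
open import Relation.Nullary.Decidable using (⌊_⌋; isYes≗does; dec-true; dec-false; does-⇔)
open import Relation.Binary.PropositionalEquality
  using (_≡_; _≢_; refl; sym; trans; cong; cong₂; subst; module ≡-Reasoning)

private
  variable
    n : ℕ
    A : Set

⌊⌋-true : (a? : Dec A) → A → ⌊ a? ⌋ ≡ true
⌊⌋-true a? a = trans (isYes≗does a?) (dec-true a? a)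

⌊⌋-false : (a? : Dec A) → ¬ A → ⌊ a? ⌋ ≡ false
⌊⌋-false a? ¬a = trans (isYes≗does a?) (dec-false a? ¬a)

lookup-N[] : (G : Graph n) (v u : Fin n) → lookup (N[ v ] G) u ≡ (⌊ v ≟ u ⌋ ∨ adj G v u)
lookup-N[] G v u = lookup∘tabulate _ u

∈N[]-intro : (G : Graph n) {v u : Fin n} → (v ≢ u → adj G v u ≡ true) → u ∈ N[ v ] G
∈N[]-intro G {v} {u} v≢u⇒adj = lookup⇒[]= u _ (trans (lookup-N[] G v u) (helper (v ≟ u)))
  where
  helper : ∀ v≟u → (⌊ v≟u ⌋ ∨ adj G v u) ≡ true
  helper (yes _)   = refl
  helper (no v≢u) rewrite v≢u⇒adj v≢u = refl

∉N[]-intro : (G : Graph n) {v u : Fin n} → v ≢ u → adj G v u ≡ false → u ∉ N[ v ] G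
∉N[]-intro G {v} {u} v≢u ¬adj u∈N = true≢false (begin
  true                      ≡⟨ sym ([]=⇒lookup u∈N) ⟩
  lookup (N[ v ] G) u       ≡⟨ lookup-N[] G v u ⟩
  ⌊ v ≟ u ⌋ ∨ adj G v u     ≡⟨ cong₂ _∨_ (⌊⌋-false (v ≟ u) v≢u) ¬adj ⟩
  false                     ∎)
  where
  open ≡-Reasoning
  true≢false : true ≢ false
  true≢false ()

WalkAvoiding-source∉ : {G : Graph n} {S : Subset n} {a c : Fin n} → WalkAvoiding G S a c → a ∉ S
WalkAvoiding-source∉ (here a∉S)     = a∉S
WalkAvoiding-source∉ (step a∉S _ _) = a∉S

WalkAvoiding-target∉ : {G : Graph n} {S : Subset n} {a c : Fin n} → WalkAvoiding G S a c → c ∉ S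
WalkAvoiding-target∉ (here a∉S)   = a∉S
WalkAvoiding-target∉ (step _ _ w) = WalkAvoiding-target∉ w

Bool-pigeonhole : (x y z : Bool) → x ≡ y ⊎ x ≡ z ⊎ y ≡ z
Bool-pigeonhole false false _     = inj₁ refl
Bool-pigeonhole true  true  _     = inj₁ refl
Bool-pigeonhole false true  false = inj₂ (inj₁ refl)
Bool-pigeonhole true  false true  = inj₂ (inj₁ refl)
Bool-pigeonhole false true  true  = inj₂ (inj₂ refl)
Bool-pigeonhole true  false false = inj₂ (inj₂ refl)

twoCliques⇒ATFree : (G : Graph n) (side : Fin n → Bool) →
                    (∀ u v → side u ≡ side v → u ∈ N[ v ] G) → ATFree G
twoCliques⇒ATFree G side clique x y z (_ , _ , _ , x⋯y , x⋯z , _)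
  with Bool-pigeonhole (side x) (side y) (side z)
... | inj₁ x~y        = WalkAvoiding-source∉ x⋯z (clique x y x~y)
... | inj₂ (inj₁ x~z) = WalkAvoiding-source∉ x⋯y (clique x z x~z)
... | inj₂ (inj₂ y~z) = WalkAvoiding-target∉ x⋯y (clique y z y~z)

splitAt-injective : ∀ a {b} {u v : Fin (a + b)} → splitAt a u ≡ splitAt a v → u ≡ v
splitAt-injective a {b} {u} {v} eq = begin
  u                    ≡⟨ sym (join-splitAt a b u) ⟩
  join a b (splitAt a u) ≡⟨ cong (join a b) eq ⟩
  join a b (splitAt a v) ≡⟨ join-splitAt a b v ⟩
  v                    ∎
  where open ≡-Reasoning

↑ˡ-or-↑ʳ : ∀ a {b} (u : Fin (a + b)) → (∃[ i ] i ↑ˡ b ≡ u) ⊎ (∃[ j ] a ↑ʳ j ≡ u)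
↑ˡ-or-↑ʳ a u with splitAt a u in eq
... | inj₁ i = inj₁ (i , splitAt⁻¹-↑ˡ eq)
... | inj₂ j = inj₂ (j , splitAt⁻¹-↑ʳ eq)

↑ʳ≢↑ˡ : ∀ a {b} (j : Fin b) (i : Fin a) → a ↑ʳ j ≢ i ↑ˡ b
↑ʳ≢↑ˡ a {b} j i eq with trans (sym (splitAt-↑ʳ a b j)) (trans (cong (splitAt a) eq) (splitAt-↑ˡ a i b))
... | ()

_≠ᵇ_ : Fin n → Fin n → Bool
i ≠ᵇ j = not ⌊ i ≟ j ⌋

≠ᵇ-sym : (i j : Fin n) → i ≠ᵇ j ≡ j ≠ᵇ i
≠ᵇ-sym i j = cong not (begin
  ⌊ i ≟ j ⌋           ≡⟨ isYes≗does (i ≟ j) ⟩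
  does (i ≟ j)        ≡⟨ does-⇔ (mk⇔ sym sym) (i ≟ j) (j ≟ i) ⟩
  does (j ≟ i)        ≡⟨ sym (isYes≗does (j ≟ i)) ⟩
  ⌊ j ≟ i ⌋           ∎)
  where open ≡-Reasoning

≠ᵇ-irrefl : (i : Fin n) → i ≠ᵇ i ≡ false
≠ᵇ-irrefl i = cong not (⌊⌋-true (i ≟ i) refl)

≢⇒≠ᵇ : {i j : Fin n} → i ≢ j → i ≠ᵇ j ≡ true
≢⇒≠ᵇ {i = i} {j} i≢j = cong not (⌊⌋-false (i ≟ j) i≢j)

++⊆⊤++⊥⇒≡⊥ : ∀ {m} (p : Subset m) (q : Subset n) → p ++ q ⊆ ⊤ {m} ++ ⊥ → q ≡ ⊥
++⊆⊤++⊥⇒≡⊥ []      q q⊆⊥ = Empty-unique (λ (_ , x∈q) → ∉⊥ (q⊆⊥ x∈q))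
++⊆⊤++⊥⇒≡⊥ (_ ∷ p) q pq⊆ = ++⊆⊤++⊥⇒≡⊥ p q (drop-∷-⊆ pq⊆)

m≤∣⊤++p∣ : ∀ m (p : Subset n) → m ≤ ∣ ⊤ {m} ++ p ∣
m≤∣⊤++p∣ zero    p = z≤n
m≤∣⊤++p∣ (suc m) p = s≤s (m≤∣⊤++p∣ m p)

module _ {a b : ℕ} (r : Fin a → Fin b → Bool) where

  crossAdj : Fin a ⊎ Fin b → Fin a ⊎ Fin b → Bool
  crossAdj (inj₁ i) (inj₁ i′) = i ≠ᵇ i′
  crossAdj (inj₂ j) (inj₂ j′) = j ≠ᵇ j′
  crossAdj (inj₁ i) (inj₂ j)  = r i j
  crossAdj (inj₂ j) (inj₁ i)  = r i j

  coBipartite : Graph (a + b)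
  coBipartite = record
    { adj    = λ u v → crossAdj (splitAt a u) (splitAt a v)
    ; sym    = λ u v → crossAdj-sym (splitAt a u) (splitAt a v)
    ; irrefl = λ v → crossAdj-irrefl (splitAt a v)
    }
    where
    crossAdj-sym : ∀ p q → crossAdj p q ≡ crossAdj q p
    crossAdj-sym (inj₁ i) (inj₁ i′) = ≠ᵇ-sym i i′
    crossAdj-sym (inj₂ j) (inj₂ j′) = ≠ᵇ-sym j j′
    crossAdj-sym (inj₁ i) (inj₂ j)  = refl
    crossAdj-sym (inj₂ j) (inj₁ i)  = refl

    crossAdj-irrefl : ∀ p → crossAdj p p ≡ false
    crossAdj-irrefl (inj₁ i) = ≠ᵇ-irrefl i
    crossAdj-irrefl (inj₂ j) = ≠ᵇ-irrefl j

  isLeft : Fin a ⊎ Fin b → Bool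
  isLeft = [ const true , const false ]′

  coBipartite-ATFree : ATFree coBipartite
  coBipartite-ATFree = twoCliques⇒ATFree coBipartite (isLeft ∘ splitAt a) clique
    where
    sameSide⇒crossAdj : ∀ p q → isLeft p ≡ isLeft q → p ≢ q → crossAdj p q ≡ true
    sameSide⇒crossAdj (inj₁ i) (inj₁ i′) _ p≢q = ≢⇒≠ᵇ (p≢q ∘ cong inj₁)
    sameSide⇒crossAdj (inj₂ j) (inj₂ j′) _ p≢q = ≢⇒≠ᵇ (p≢q ∘ cong inj₂)
    sameSide⇒crossAdj (inj₁ i) (inj₂ j)  () _
    sameSide⇒crossAdj (inj₂ j) (inj₁ i)  () _

    clique : ∀ u v → isLeft (splitAt a u) ≡ isLeft (splitAt a v) → u ∈ N[ v ] coBipartite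
    clique u v same = ∈N[]-intro coBipartite λ v≢u →
      sameSide⇒crossAdj (splitAt a v) (splitAt a u) (sym same) (v≢u ∘ splitAt-injective a)

  column : Fin b → Subset a
  column j = tabulate (λ i → r i j)

  left : Subset (a + b)
  left = ⊤ {a} ++ ⊥ {b}

  N[↑ʳ]∩left : ∀ j → N[ a ↑ʳ j ] coBipartite ∩ left ≡ column j ++ ⊥
  N[↑ʳ]∩left j = Pointwise-≡⇒≡ (ext pointwise)
    where
    open ≡-Reasoning
    N = N[ a ↑ʳ j ] coBipartite

    pointwise : ∀ u → lookup (N ∩ left) u ≡ lookup (column j ++ ⊥) u
    pointwise u with ↑ˡ-or-↑ʳ a u
    ... | inj₁ (i , refl) = begin
      lookup (N ∩ left) (i ↑ˡ b)                      ≡⟨ lookup-zipWith _∧_ (i ↑ˡ b) N left ⟩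
      lookup N (i ↑ˡ b) ∧ lookup left (i ↑ˡ b)        ≡⟨ cong₂ _∧_ (lookup-N[] coBipartite _ _)
                                                           (trans (lookup-++ˡ (⊤ {a}) (⊥ {b}) i) (lookup-replicate i true)) ⟩
      (⌊ a ↑ʳ j ≟ i ↑ˡ b ⌋ ∨ crossAdj (splitAt a (a ↑ʳ j)) (splitAt a (i ↑ˡ b))) ∧ true
                                                      ≡⟨ ∧-identityʳ _ ⟩
      ⌊ a ↑ʳ j ≟ i ↑ˡ b ⌋ ∨ crossAdj (splitAt a (a ↑ʳ j)) (splitAt a (i ↑ˡ b))
                                                      ≡⟨ cong₂ _∨_ (⌊⌋-false (a ↑ʳ j ≟ i ↑ˡ b) (↑ʳ≢↑ˡ a j i))
                                                           (cong₂ crossAdj (splitAt-↑ʳ a b j) (splitAt-↑ˡ a i b)) ⟩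
      r i j                                           ≡⟨ sym (lookup∘tabulate (λ i → r i j) i) ⟩
      lookup (column j) i                             ≡⟨ sym (lookup-++ˡ (column j) ⊥ i) ⟩
      lookup (column j ++ ⊥) (i ↑ˡ b)                 ∎
    ... | inj₂ (k , refl) = begin
      lookup (N ∩ left) (a ↑ʳ k)                      ≡⟨ lookup-zipWith _∧_ (a ↑ʳ k) N left ⟩
      lookup N (a ↑ʳ k) ∧ lookup left (a ↑ʳ k)        ≡⟨ cong (lookup N (a ↑ʳ k) ∧_)
                                                           (trans (lookup-++ʳ (⊤ {a}) (⊥ {b}) k) (lookup-replicate k false)) ⟩
      lookup N (a ↑ʳ k) ∧ false                       ≡⟨ ∧-zeroʳ _ ⟩
      false                                           ≡⟨ sym (trans (lookup-++ʳ (column j) ⊥ k) (lookup-replicate k false)) ⟩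
      lookup (column j ++ ⊥) (a ↑ʳ k)                 ∎

  coBipartite-shatters-left : (∀ p → ∃[ j ] column j ≡ p) → Shattered coBipartite left
  coBipartite-shatters-left onto Y Y⊆left with Vec.splitAt a Y
  ... | p , q , refl with onto p
  ... | j , column≡p = a ↑ʳ j , (begin
    N[ a ↑ʳ j ] coBipartite ∩ left ≡⟨ N[↑ʳ]∩left j ⟩
    column j ++ ⊥                   ≡⟨ cong₂ _++_ column≡p (sym (++⊆⊤++⊥⇒≡⊥ p q Y⊆left)) ⟩
    p ++ q                          ∎)
    where open ≡-Reasoning

∣p∣<n⇒∃∉ : (p : Subset n) → ∣ p ∣ < n → ∃[ x ] x ∉ p
∣p∣<n⇒∃∉ (outside ∷ p) _        = zero , λ ()
∣p∣<n⇒∃∉ (inside  ∷ p) (s≤s lt) with ∣p∣<n⇒∃∉ p lt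
... | x , x∉p = suc x , x∉p ∘ drop-there

∣p∣<n⇒∃↑ʳ∉ : ∀ a (p : Subset (a + n)) → ∣ p ∣ < n → ∃[ i ] a ↑ʳ i ∉ p
∣p∣<n⇒∃↑ʳ∉ zero    p          lt = ∣p∣<n⇒∃∉ p lt
∣p∣<n⇒∃↑ʳ∉ (suc a) (s ∷ p) lt with ∣p∣<n⇒∃↑ʳ∉ a p (≤-<-trans (∣p∣≤∣x∷p∣ s p) lt)
... | i , a↑ʳi∉p = i , a↑ʳi∉p ∘ drop-there

cocktailParty : (k : ℕ) → Graph (k + k)
cocktailParty k = coBipartite (_≠ᵇ_ {k})

module _ {k : ℕ} where

  private
    G = cocktailParty k
    cpAdj = crossAdj (_≠ᵇ_ {k})

  partner : Fin (k + k) → Fin (k + k)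
  partner x = join k k (swap (splitAt k x))

  splitAt-partner : ∀ x → splitAt k (partner x) ≡ swap (splitAt k x)
  splitAt-partner x = splitAt-join k k (swap (splitAt k x))

  ∉N[partner] : ∀ x → x ∉ N[ partner x ] G
  ∉N[partner] x = ∉N[]-intro G partner≢x
    (trans (cong (λ p → cpAdj p (splitAt k x)) (splitAt-partner x)) (¬adj-swap (splitAt k x)))
    where
    swap≢ : (p : Fin k ⊎ Fin k) → swap p ≢ p
    swap≢ (inj₁ _) ()
    swap≢ (inj₂ _) ()

    partner≢x : partner x ≢ x
    partner≢x eq = swap≢ (splitAt k x) (trans (sym (splitAt-partner x)) (cong (splitAt k) eq))

    ¬adj-swap : ∀ p → cpAdj (swap p) p ≡ false
    ¬adj-swap (inj₁ i) = ≠ᵇ-irrefl i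
    ¬adj-swap (inj₂ i) = ≠ᵇ-irrefl i

  ∈N[]-unless-partner : ∀ {v x} → v ≢ partner x → x ∈ N[ v ] G
  ∈N[]-unless-partner {v} {x} v≢partner = ∈N[]-intro G λ v≢x →
    adj-unless-swap (splitAt k v) (splitAt k x) (v≢x ∘ splitAt-injective k)
      (λ eq → v≢partner (splitAt-injective k (trans eq (sym (splitAt-partner x)))))
    where
    adj-unless-swap : ∀ p q → p ≢ q → p ≢ swap q → cpAdj p q ≡ true
    adj-unless-swap (inj₁ i) (inj₁ j) p≢q _  = ≢⇒≠ᵇ (p≢q ∘ cong inj₁)
    adj-unless-swap (inj₂ i) (inj₂ j) p≢q _  = ≢⇒≠ᵇ (p≢q ∘ cong inj₂)
    adj-unless-swap (inj₁ i) (inj₂ j) _ p≢sq = ≢⇒≠ᵇ (p≢sq ∘ cong inj₁)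
    adj-unless-swap (inj₂ j) (inj₁ i) _ p≢sq = ≢⇒≠ᵇ (p≢sq ∘ cong inj₂ ∘ sym)

  cocktailParty-HellyNumber≥ : HellyNumberAtLeast G k
  cocktailParty-HellyNumber≥ j helly = ≮⇒≥ λ j<k → noCommonElement (helly ⊤ (jWise j<k))
    where
    noCommonElement : ¬ HasCommonElement G ⊤
    noCommonElement (x , x∈N[all]) = ∉N[partner] x (x∈N[all] (partner x) ∈⊤)

    -- A family of fewer than k vertices misses some right vertex k ↑ʳ i,
    -- the partner of i ↑ˡ k, so i ↑ˡ k lies in every member's neighbourhood.
    jWise : j < k → KWiseIntersecting G j ⊤
    jWise j<k S _ ∣S∣≤j with ∣p∣<n⇒∃↑ʳ∉ k S (≤-<-trans ∣S∣≤j j<k)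
    ... | i , k↑ʳi∉S = i ↑ˡ k , λ v v∈S → ∈N[]-unless-partner λ v≡partner →
      k↑ʳi∉S (subst (_∈ S) (trans v≡partner (cong (join k k ∘ swap) (splitAt-↑ˡ k i k))) v∈S)

-- Column j is the subset of Fin d with characteristic function finToFun j.
powersetRelation : ∀ d → Fin d → Fin (2 ^ d) → Bool
powersetRelation d i j = Inverse.to 2↔Bool (finToFun j i)

powersetRelation-columns-onto : ∀ d (p : Subset d) → ∃[ j ] column (powersetRelation d) j ≡ p
powersetRelation-columns-onto d p = j , (begin
  tabulate (λ i → Inverse.to 2↔Bool (finToFun j i)) ≡⟨ tabulate-cong finToFun-j ⟩
  tabulate (lookup p)                                ≡⟨ tabulate∘lookup p ⟩
  p                                                  ∎)
  where
  open ≡-Reasoning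
  j = funToFin (Inverse.from 2↔Bool ∘ lookup p)

  finToFun-j : ∀ i → Inverse.to 2↔Bool (finToFun j i) ≡ lookup p i
  finToFun-j i = trans (cong (Inverse.to 2↔Bool) (finToFun-funToFin (Inverse.from 2↔Bool ∘ lookup p) i))
                       (Inverse.strictlyInverseˡ 2↔Bool (lookup p i))

proposition1 : ((k : ℕ) → 1 ≤ k → ∃[ n ] Σ (Graph n) (λ G → ATFree G × HellyNumberAtLeast G k))
               × ((d : ℕ) → 1 ≤ d → ∃[ n ] Σ (Graph n) (λ G → ATFree G × VCDimAtLeast G d))
proposition1 =
  (λ k _ → k + k , cocktailParty k , coBipartite-ATFree (_≠ᵇ_ {k}) , cocktailParty-HellyNumber≥) ,
  (λ d _ → d + 2 ^ d , coBipartite (powersetRelation d) , coBipartite-ATFree (powersetRelation d) ,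
           left (powersetRelation d) ,
           coBipartite-shatters-left (powersetRelation d) (powersetRelation-columns-onto d) ,
           m≤∣⊤++p∣ d ⊥)
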